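{- Let $n\ge 2$ and let $\Gamma$ be a graph obtained from the complete graph $K_{2n}$ by removing the edges of a perfect matching. Let $\Sigma$ be a connected, non-bipartite, $R$-thin graph. Then the semi-strong product $\Gamma\ltimes\Sigma$ is nontrivially unstable.
   Context: All graphs are finite, undirected and simple. The semi-strong product $\Gamma\ltimes\Sigma$ has vertex set $V(\Gamma)\times V(\Sigma)$ with $(a,x)\sim(b,y)$ iff ($a\sim_\Gamma b$ or $a=b$) and $x\sim_\Sigma y$. A graph is $R$-thin if no two distinct vertices have the same neighbourhood. A graph $\Lambda$ is stable if $\mathrm{Aut}(\Lambda\times K_2)=\mathrm{Aut}(\Lambda)\times\mathrm{Aut}(K_2)$, where $\Lambda\times K_2$ is the direct product (vertex set $V(\Lambda)\times V(K_2)$, $(a,x)\sim(b,y)$ iff $a\sim b$ and $x\sim y$) on which $\mathrm{Aut}(\Lambda)\times\mathrm{Aut}(K_2)$ acts coordinatewise; otherwise unstable. A graph is nontrivially unstable if it is unstable, connected, non-bipartite and $R$-thin. -}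

module Defs where

open import Data.Nat using (ℕ)
open import Data.Fin using (Fin)
open import Data.Bool using (Bool)
open import Data.Product using (Σ; ∃; _×_; _,_)
open import Data.Sum using (_⊎_)
open import Relation.Nullary using (¬_)
open import Relation.Binary.PropositionalEquality using (_≡_; _≢_)
open import Relation.Binary.Definitions using (Decidable)
open import Function.Definitions using (Bijective)
open import Function.Bundles using (_⇔_)

Rel : Set → Set₁
Rel V = V → V → Set

data Walk {V : Set} (R : Rel V) : V → V → Set where
  here  : ∀ {u} → Walk R u u
  step  : ∀ {u v w} → R u v → Walk R v w → Walk R u w

Connected : {V : Set} → Rel V → Set
Connected R = ∀ u v → Walk R u v

Bipartite : {V : Set} → Rel V → Set
Bipartite {V} R = Σ (V → Bool) λ c → ∀ u v → R u v → c u ≢ c v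

RThin : {V : Set} → Rel V → Set
RThin {V} R = ∀ u v → (∀ w → (R w u ⇔ R w v)) → u ≡ v

record Aut {V : Set} (R : Rel V) : Set where
  field
    fun       : V → V
    bijective : Bijective _≡_ _≡_ fun
    preserves : ∀ u v → (R u v ⇔ R (fun u) (fun v))

K₂ : Rel (Fin 2)
K₂ x y = x ≢ y

_×K₂ : {V : Set} → Rel V → Rel (V × Fin 2)
(R ×K₂) (a , x) (b , y) = R a b × K₂ x y

-- Stable: Aut(Λ × K₂) = Aut(Λ) × Aut(K₂) (acting coordinatewise).
-- The inclusion ⊇ always holds, so this says every automorphism of
-- Λ × K₂ is of the coordinatewise form (a , x) ↦ (σ a , τ x).
Stable : {V : Set} → Rel V → Set
Stable {V} R = (φ : Aut (R ×K₂)) →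
  Σ (Aut R) λ σ → Σ (Aut K₂) λ τ →
    ∀ a x → Aut.fun φ (a , x) ≡ (Aut.fun σ a , Aut.fun τ x)

Unstable : {V : Set} → Rel V → Set
Unstable R = ¬ Stable R

NontriviallyUnstable : {V : Set} → Rel V → Set
NontriviallyUnstable R = Unstable R × Connected R × ¬ Bipartite R × RThin R

record FinGraph (m : ℕ) : Set₁ where
  field
    adj     : Rel (Fin m)
    adj-sym : ∀ {x y} → adj x y → adj y x
    irrefl  : ∀ {x} → ¬ adj x x
    adj-dec : Decidable adj

-- perfect matching on Fin k: a fixed-point-free involution μ
-- (the matching edges are {a , μ a})
record PerfectMatching (k : ℕ) : Set where
  field
    μ        : Fin k → Fin k
    involutive : ∀ a → μ (μ a) ≡ a
    no-fixed : ∀ a → μ a ≢ a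

CompleteMinusMatching : {k : ℕ} → PerfectMatching k → Rel (Fin k)
CompleteMinusMatching M a b = a ≢ b × b ≢ PerfectMatching.μ M a

semiStrong : {V W : Set} → Rel V → Rel W → Rel (V × W)
semiStrong RΓ RΣ (a , x) (b , y) = (RΓ a b ⊎ a ≡ b) × RΣ x y

{-# OPTIONS --safe #-}
module Submission where

-- A two-fold automorphism of Λ is a pair of permutations (π₀ , π₁) with
-- a ∼ b ⇔ π₀ a ∼ π₁ b; it acts on Λ ×K₂ as π₀ on one layer and π₁ on the
-- other, and if π₀ ≠ π₁ this automorphism is not coordinatewise, so Λ is
-- unstable. In Γ ⋉ Σ adjacency is closed adjacency in Γ times adjacency in
-- Σ, so two-fold automorphisms of the reflexive closure of Γ lift to Γ ⋉ Σ.
-- For Γ = K₂ₙ minus a matching μ that closure is the relation b ≠ μ a,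
-- preserved by (π , μ π μ) for every permutation π; the transposition π of
-- a and some c ∉ {a , μ a} moves a while μ π μ fixes it.
-- Connectivity, non-bipartiteness and R-thinness pass from Σ to Γ ⋉ Σ since
-- Σ has no isolated vertices and distinct vertices of Γ have distinct
-- closed neighbourhoods.

open import Defs
open import Data.Nat using (ℕ; _≤_; _*_; s≤s; z≤n)
open import Data.Nat.Properties using (≤-trans; *-monoʳ-≤)
open import Data.Fin using (Fin; zero; suc; _≟_; punchIn; punchOut; fromℕ<)
open import Data.Fin.Properties using (any?; punchInᵢ≢i; punchIn-injective; punchIn-punchOut)
import Data.Fin.Permutation as Permutation
import Data.Fin.Permutation.Components as Transposition
open import Data.Bool using (true)
open import Data.Product using (Σ; ∃; _×_; _,_; proj₁; proj₂)
open import Data.Product.Function.NonDependent.Propositional using (_×-↔_; _×-⇔_)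
open import Data.Sum using (_⊎_; inj₁; inj₂)
import Data.Sum as Sum
open import Data.Empty using (⊥-elim)
open import Function using (_∘_)
open import Function.Bundles using (_⇔_; _↔_; mk⇔; mk↔ₛ′; Inverse; Bijection; Equivalence)
open import Function.Construct.Identity using (↔-id; ⇔-id)
open import Function.Construct.Composition using (_↔-∘_; _⇔-∘_)
open import Function.Construct.Symmetry using (↔-sym; ⇔-sym)
open import Function.Properties.Inverse using (↔⇒⤖)
open import Function.Related.TypeIsomorphisms using (¬-cong-⇔)
open import Relation.Nullary using (¬_; yes; no)
open import Relation.Nullary.Decidable using (dec-true; dec-false)
open import Relation.Binary.Definitions using (Symmetric; Decidable)
open import Relation.Binary.PropositionalEquality
  using (_≡_; _≢_; refl; sym; trans; cong; cong₂; module ≡-Reasoning)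

open Inverse using (to; from)

ReflClosure : {V : Set} → Rel V → Rel V
ReflClosure R a b = R a b ⊎ a ≡ b

NoIsolatedVertex : {V : Set} → Rel V → Set
NoIsolatedVertex R = ∀ u → ∃ (R u)

module _ {V : Set} {R : Rel V} where

  _++ʷ_ : ∀ {u v w} → Walk R u v → Walk R v w → Walk R u w
  here     ++ʷ q = q
  step r p ++ʷ q = step r (p ++ʷ q)

  walk-map : {W : Set} {S : Rel W} (f : V → W) → (∀ {u v} → R u v → S (f u) (f v)) →
             ∀ {u v} → Walk R u v → Walk S (f u) (f v)
  walk-map f hom here       = here
  walk-map f hom (step r p) = step (hom r) (walk-map f hom p)

  walk-from-isolated : ∀ {u v} → (∀ w → ¬ R u w) → Walk R u v → v ≡ u
  walk-from-isolated isolated here       = refl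
  walk-from-isolated isolated (step r _) = ⊥-elim (isolated _ r)

  connected-isolated⇒edgeless : Connected R → ∀ {u} → (∀ w → ¬ R u w) → ∀ v w → ¬ R v w
  connected-isolated⇒edgeless conn {u} isolated v w r
    with walk-from-isolated isolated (conn u v)
  ... | refl = isolated w r

  edgeless⇒bipartite : (∀ v w → ¬ R v w) → Bipartite R
  edgeless⇒bipartite edgeless = (λ _ → true) , λ v w r → ⊥-elim (edgeless v w r)

  ReflClosure-symmetric : Symmetric R → Symmetric (ReflClosure R)
  ReflClosure-symmetric R-sym = Sum.map R-sym sym

nonbipartite⇒inhabited : ∀ {m} {R : Rel (Fin m)} → ¬ Bipartite R → Fin m
nonbipartite⇒inhabited {ℕ.zero}  ¬bip = ⊥-elim (¬bip ((λ ()) , λ ()))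
nonbipartite⇒inhabited {ℕ.suc _} _    = zero

connected-nonbipartite⇒noIsolatedVertex : ∀ {m} {R : Rel (Fin m)} → Decidable R →
  Connected R → ¬ Bipartite R → NoIsolatedVertex R
connected-nonbipartite⇒noIsolatedVertex R? conn ¬bip u with any? (R? u)
... | yes neighbour = neighbour
... | no ¬neighbour =
  ⊥-elim (¬bip (edgeless⇒bipartite (connected-isolated⇒edgeless conn λ w r → ¬neighbour (w , r))))

∃-avoiding-pair : ∀ {N} → 3 ≤ N → {p q : Fin N} → p ≢ q → ∃ λ c → c ≢ p × c ≢ q
∃-avoiding-pair {ℕ.suc (ℕ.suc (ℕ.suc k))} (s≤s (s≤s (s≤s _))) {p} {q} p≢q =
  punchIn p c′ , punchInᵢ≢i p c′ , c≢q
  where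
  q′ : Fin (ℕ.suc (ℕ.suc k))
  q′ = punchOut p≢q
  c′ : Fin (ℕ.suc (ℕ.suc k))
  c′ = punchIn q′ zero
  c≢q : punchIn p c′ ≢ q
  c≢q c≡q = punchInᵢ≢i q′ zero
    (punchIn-injective p c′ q′ (trans c≡q (sym (punchIn-punchOut p≢q))))

record TwoFoldAut {V : Set} (R : Rel V) : Set where
  field
    π₀ π₁     : V ↔ V
    preserves : ∀ a b → R a b ⇔ R (to π₀ a) (to π₁ b)

TwoFoldAut-resp-⇔ : {V : Set} {R S : Rel V} → (∀ a b → R a b ⇔ S a b) →
  TwoFoldAut R → TwoFoldAut S
TwoFoldAut-resp-⇔ R⇔S t = record
  { π₀ = π₀
  ; π₁ = π₁
  ; preserves = λ a b → R⇔S (to π₀ a) (to π₁ b) ⇔-∘ (preserves a b ⇔-∘ ⇔-sym (R⇔S a b))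
  }
  where open TwoFoldAut t

NontrivialTwoFoldAut : {V : Set} → Rel V → Set
NontrivialTwoFoldAut R =
  Σ (TwoFoldAut R) λ t → ∃ λ a → to (TwoFoldAut.π₀ t) a ≢ to (TwoFoldAut.π₁ t) a

module _ {V : Set} {R : Rel V} (R-sym : Symmetric R) (t : TwoFoldAut R) where

  open TwoFoldAut t

  layer : Fin 2 → V ↔ V
  layer zero       = π₀
  layer (suc zero) = π₁

  layer-preserves : ∀ {i j} → K₂ i j → ∀ a b → R a b ⇔ R (to (layer i) a) (to (layer j) b)
  layer-preserves {zero}     {zero}     i≢j = ⊥-elim (i≢j refl)
  layer-preserves {zero}     {suc zero} _   = preserves
  layer-preserves {suc zero} {zero}     _   a b =
    swap (to π₀ b) (to π₁ a) ⇔-∘ (preserves b a ⇔-∘ swap a b)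
    where
    swap : ∀ u v → R u v ⇔ R v u
    swap _ _ = mk⇔ R-sym R-sym
  layer-preserves {suc zero} {suc zero} i≢j = ⊥-elim (i≢j refl)

  layered : (V × Fin 2) ↔ (V × Fin 2)
  layered = mk↔ₛ′ (λ (a , i) → to (layer i) a , i) (λ (a , i) → from (layer i) a , i)
    (λ (a , i) → cong (_, i) (Inverse.strictlyInverseˡ (layer i) a))
    (λ (a , i) → cong (_, i) (Inverse.strictlyInverseʳ (layer i) a))

  twoFold⇒aut : Aut (R ×K₂)
  twoFold⇒aut = record
    { fun       = to layered
    ; bijective = Bijection.bijective (↔⇒⤖ layered)
    ; preserves = λ (a , i) (b , j) → mk⇔
        (λ (r , i≢j) → Equivalence.to   (layer-preserves i≢j a b) r , i≢j)
        (λ (r , i≢j) → Equivalence.from (layer-preserves i≢j a b) r , i≢j)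
    }

nontrivialTwoFold⇒unstable : {V : Set} {R : Rel V} → NontrivialTwoFoldAut R → Symmetric R →
  Unstable R
nontrivialTwoFold⇒unstable (t , a , π₀a≢π₁a) R-sym stable
  with stable (twoFold⇒aut R-sym t)
... | σ , τ , coordinatewise = π₀a≢π₁a (begin
  to π₀ a     ≡⟨ cong proj₁ (coordinatewise a zero) ⟩
  Aut.fun σ a ≡⟨ cong proj₁ (coordinatewise a (suc zero)) ⟨
  to π₁ a     ∎)
  where
  open TwoFoldAut t
  open ≡-Reasoning

module _ {VΓ VΣ : Set} {RΓ : Rel VΓ} {RΣ : Rel VΣ} where

  semiStrong-symmetric : Symmetric RΓ → Symmetric RΣ → Symmetric (semiStrong RΓ RΣ)
  semiStrong-symmetric Γ-sym Σ-sym (r , s) = ReflClosure-symmetric Γ-sym r , Σ-sym s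

  semiStrong-fibre : ∀ a {x y} → Walk RΣ x y → Walk (semiStrong RΓ RΣ) (a , x) (a , y)
  semiStrong-fibre a = walk-map (a ,_) (inj₂ refl ,_)

  semiStrong-connected : Connected (ReflClosure RΓ) → NoIsolatedVertex RΣ → Connected RΣ →
    Connected (semiStrong RΓ RΣ)
  semiStrong-connected Γ-conn Σ-noIso Σ-conn (a , x) (b , y) =
    semiStrong-fibre a (Σ-conn x y) ++ʷ along (Γ-conn a b)
    where
    along : ∀ {a b} → Walk (ReflClosure RΓ) a b → Walk (semiStrong RΓ RΣ) (a , y) (b , y)
    along here       = here
    along (step r p) with Σ-noIso y
    ... | z , yz = step (r , yz) (semiStrong-fibre _ (Σ-conn z y) ++ʷ along p)

  semiStrong-nonbipartite : VΓ → ¬ Bipartite RΣ → ¬ Bipartite (semiStrong RΓ RΣ)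
  semiStrong-nonbipartite a ¬bip (colour , proper) =
    ¬bip (colour ∘ (a ,_) , λ x y s → proper (a , x) (a , y) (inj₂ refl , s))

  semiStrong-RThin : Symmetric RΣ → NoIsolatedVertex RΣ → RThin (ReflClosure RΓ) → RThin RΣ →
    RThin (semiStrong RΓ RΣ)
  semiStrong-RThin Σ-sym Σ-noIso Γ-thin Σ-thin (a , x) (b , y) sameNbhd =
    cong₂ _,_ (Γ-thin a b λ c → mk⇔ (base sameNbhd c) (base (⇔-sym ∘ sameNbhd) c))
              (Σ-thin x y λ w → mk⇔ (fibre sameNbhd w) (fibre (⇔-sym ∘ sameNbhd) w))
    where
    base : ∀ {a x b y} → (∀ v → semiStrong RΓ RΣ v (a , x) ⇔ semiStrong RΓ RΣ v (b , y)) →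
      ∀ c → ReflClosure RΓ c a → ReflClosure RΓ c b
    base {x = x} same c r with Σ-noIso x
    ... | z , xz = proj₁ (Equivalence.to (same (c , z)) (r , Σ-sym xz))
    fibre : ∀ {a x b y} → (∀ v → semiStrong RΓ RΣ v (a , x) ⇔ semiStrong RΓ RΣ v (b , y)) →
      ∀ w → RΣ w x → RΣ w y
    fibre {a} same w s = proj₂ (Equivalence.to (same (a , w)) (inj₂ refl , s))

  semiStrong-twoFold : TwoFoldAut (ReflClosure RΓ) → TwoFoldAut (semiStrong RΓ RΣ)
  semiStrong-twoFold t = record
    { π₀        = π₀ ×-↔ ↔-id VΣ
    ; π₁        = π₁ ×-↔ ↔-id VΣ
    ; preserves = λ (a , x) (b , y) → preserves a b ×-⇔ ⇔-id (RΣ x y)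
    }
    where open TwoFoldAut t

  semiStrong-nontrivialTwoFold : VΣ → NontrivialTwoFoldAut (ReflClosure RΓ) →
    NontrivialTwoFoldAut (semiStrong RΓ RΣ)
  semiStrong-nontrivialTwoFold x (t , a , π₀a≢π₁a) =
    semiStrong-twoFold t , (a , x) , π₀a≢π₁a ∘ cong proj₁

OffGraph : {V : Set} → V ↔ V → Rel V
OffGraph f a b = b ≢ to f a

OffGraph-twoFold : {V : Set} (f π : V ↔ V) → TwoFoldAut (OffGraph f)
OffGraph-twoFold f π = record
  { π₀        = π
  ; π₁        = f ↔-∘ (π ↔-∘ ↔-sym f)
  ; preserves = λ a b → ¬-cong-⇔ (mk⇔ (conjugate a b) (unconjugate a b))
  }
  where
  injective : ∀ g → ∀ {u v} → to g u ≡ to g v → u ≡ v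
  injective g = Bijection.injective (↔⇒⤖ g)
  conjugate : ∀ a b → b ≡ to f a → to f (to π (from f b)) ≡ to f (to π a)
  conjugate a b refl = cong (to f ∘ to π) (Inverse.strictlyInverseʳ f a)
  unconjugate : ∀ a b → to f (to π (from f b)) ≡ to f (to π a) → b ≡ to f a
  unconjugate a b eq =
    trans (sym (Inverse.strictlyInverseˡ f b)) (cong (to f) (injective π (injective f eq)))

transpose-matchˡ : ∀ {n} (i j : Fin n) → Transposition.transpose i j i ≡ j
transpose-matchˡ i j rewrite dec-true (i ≟ i) refl = refl

transpose-fixes : ∀ {n} {i j k : Fin n} → k ≢ i → k ≢ j → Transposition.transpose i j k ≡ k
transpose-fixes {i = i} {j} {k} k≢i k≢j
  rewrite dec-false (k ≟ i) k≢i | dec-false (k ≟ j) k≢j = refl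

module _ {N : ℕ} (M : PerfectMatching N) where

  open PerfectMatching M

  private
    Γ : Rel (Fin N)
    Γ = CompleteMinusMatching M

  μ↔ : Fin N ↔ Fin N
  μ↔ = mk↔ₛ′ μ μ involutive involutive

  μ-injective : ∀ {a b} → μ a ≡ μ b → a ≡ b
  μ-injective = Bijection.injective (↔⇒⤖ μ↔)

  CompleteMinusMatching-symmetric : Symmetric Γ
  CompleteMinusMatching-symmetric {a} {b} (a≢b , b≢μa) =
    a≢b ∘ sym , λ a≡μb → b≢μa (trans (sym (involutive b)) (cong μ (sym a≡μb)))

  CompleteMinusMatching-closure⇔OffGraph : ∀ a b → ReflClosure Γ a b ⇔ OffGraph μ↔ a b
  CompleteMinusMatching-closure⇔OffGraph a b = mk⇔ closed⇒off off⇒closed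
    where
    closed⇒off : ReflClosure Γ a b → b ≢ μ a
    closed⇒off (inj₁ (_ , b≢μa)) = b≢μa
    closed⇒off (inj₂ refl)       = no-fixed a ∘ sym
    off⇒closed : b ≢ μ a → ReflClosure Γ a b
    off⇒closed b≢μa with a ≟ b
    ... | yes a≡b = inj₂ a≡b
    ... | no a≢b  = inj₁ (a≢b , b≢μa)

  private
    closed : ∀ {a b} → b ≢ μ a → ReflClosure Γ a b
    closed = Equivalence.from (CompleteMinusMatching-closure⇔OffGraph _ _)

  CompleteMinusMatching-closure-connected : 3 ≤ N → Connected (ReflClosure Γ)
  CompleteMinusMatching-closure-connected 3≤N a b with b ≟ μ a
  ... | no b≢μa = step (closed b≢μa) here
  ... | yes refl with ∃-avoiding-pair 3≤N (no-fixed a ∘ sym)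
  ...   | c , c≢a , c≢μa = step (closed c≢μa) (step (closed (c≢a ∘ μ-injective ∘ sym)) here)

  CompleteMinusMatching-closure-RThin : RThin (ReflClosure Γ)
  CompleteMinusMatching-closure-RThin a b sameNbhd with a ≟ b
  ... | yes a≡b = a≡b
  ... | no a≢b  = ⊥-elim (Equivalence.to (CompleteMinusMatching-closure⇔OffGraph (μ a) a)
                    (Equivalence.from (sameNbhd (μ a)) (closed (a≢b ∘ sym ∘ b≡a)))
                    (sym (involutive a)))
    where
    b≡a : b ≡ μ (μ a) → b ≡ a
    b≡a b≡μμa = trans b≡μμa (involutive a)

  CompleteMinusMatching-closure-nontrivialTwoFold : 3 ≤ N → Fin N →
    NontrivialTwoFoldAut (ReflClosure Γ)
  CompleteMinusMatching-closure-nontrivialTwoFold 3≤N a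
    with ∃-avoiding-pair 3≤N (no-fixed a ∘ sym)
  ... | c , c≢a , c≢μa =
    TwoFoldAut-resp-⇔ (λ u v → ⇔-sym (CompleteMinusMatching-closure⇔OffGraph u v))
                      (OffGraph-twoFold μ↔ (Permutation.transpose a c)) ,
    a , λ c≡a′ → c≢a (trans (sym (transpose-matchˡ a c)) (trans c≡a′ a′≡a))
    where
    a′≡a : μ (Transposition.transpose a c (μ a)) ≡ a
    a′≡a = trans (cong μ (transpose-fixes (no-fixed a) (c≢μa ∘ sym))) (involutive a)

proposition6p2 : (n : ℕ) → 2 ≤ n → (M : PerfectMatching (2 * n)) →
    (m : ℕ) → (S : FinGraph m) →
    Connected (FinGraph.adj S) → ¬ Bipartite (FinGraph.adj S) → RThin (FinGraph.adj S) →
    NontriviallyUnstable (semiStrong (CompleteMinusMatching M) (FinGraph.adj S))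
proposition6p2 n 2≤n M m S conn ¬bip thin =
    nontrivialTwoFold⇒unstable
      (semiStrong-nontrivialTwoFold (nonbipartite⇒inhabited ¬bip)
        (CompleteMinusMatching-closure-nontrivialTwoFold M 3≤2n a₀))
      (semiStrong-symmetric {RΣ = adj} (CompleteMinusMatching-symmetric M) adj-sym)
  , semiStrong-connected (CompleteMinusMatching-closure-connected M 3≤2n) noIsolated conn
  , semiStrong-nonbipartite a₀ ¬bip
  , semiStrong-RThin adj-sym noIsolated (CompleteMinusMatching-closure-RThin M) thin
  where
  open FinGraph S
  3≤2n : 3 ≤ 2 * n
  3≤2n = ≤-trans (s≤s (s≤s (s≤s z≤n))) (*-monoʳ-≤ 2 2≤n)
  a₀ : Fin (2 * n)
  a₀ = fromℕ< 3≤2n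
  noIsolated : NoIsolatedVertex adj
  noIsolated = connected-nonbipartite⇒noIsolatedVertex adj-dec conn ¬bip
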